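{- For every $n\ge 1$, the set $\mathscr{G}_n$ of Grassmannian permutations of $[n]$ is in bijection with the set of Dyck paths of semilength $n$ having at most one long ascent.
   Context: A permutation is Grassmannian if it has at most one descent (a position $i$ with $\pi(i)>\pi(i+1)$). A Dyck path of semilength $n$ is a lattice path from $(0,0)$ to $(2n,0)$ with up-steps $\mathsf{U}=(1,1)$ and down-steps $\mathsf{D}=(1,-1)$ never going below the $x$-axis. A long ascent is a maximal run of two or more consecutive up-steps. -}

module Defs where

open import Data.Nat using (ℕ; zero; suc; _+_; _≤_; _<ᵇ_; _≤ᵇ_; _≡ᵇ_)
open import Data.Bool using (Bool; true; false; _∧_; _∨_; not; T; if_then_else_)
open import Data.Fin using (Fin; toℕ)
open import Data.Vec using (Vec; []; _∷_; toList)
open import Data.List using (List; []; _∷_; length)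
open import Data.Product using (Σ)

-- Permutations of [n] in one-line notation: a vector (π(1),…,π(n)) of
-- elements of Fin n with pairwise distinct entries (equivalently a
-- bijection [n] → [n], since Fin n is finite).

distinctFrom : ∀ {n} → Fin n → List (Fin n) → Bool
distinctFrom x [] = true
distinctFrom x (y ∷ ys) = not (toℕ x ≡ᵇ toℕ y) ∧ distinctFrom x ys

allDistinct : ∀ {n} → List (Fin n) → Bool
allDistinct [] = true
allDistinct (x ∷ xs) = distinctFrom x xs ∧ allDistinct xs

Perm : ℕ → Set
Perm n = Σ (Vec (Fin n) n) (λ w → T (allDistinct (toList w)))

descents : ∀ {n} → List (Fin n) → ℕ
descents [] = 0
descents (x ∷ []) = 0
descents (x ∷ y ∷ ys) = (if toℕ y <ᵇ toℕ x then 1 else 0) + descents (y ∷ ys)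

isGrassmannian : ∀ {n} → Vec (Fin n) n → Bool
isGrassmannian w = descents (toList w) ≤ᵇ 1

Grassmannian : ℕ → Set
Grassmannian n =
  Σ (Vec (Fin n) n) (λ w → T (allDistinct (toList w) ∧ isGrassmannian w))

data Step : Set where
  U D : Step

dyckFrom : ℕ → List Step → Bool
dyckFrom zero [] = true
dyckFrom (suc h) [] = false
dyckFrom h (U ∷ s) = dyckFrom (suc h) s
dyckFrom zero (D ∷ s) = false
dyckFrom (suc h) (D ∷ s) = dyckFrom h s

isDyck : List Step → Bool
isDyck = dyckFrom 0

longAscentsAux : ℕ → List Step → ℕ
longAscentsAux k (U ∷ s) = longAscentsAux (suc k) s
longAscentsAux k (D ∷ s) = (if 2 ≤ᵇ k then 1 else 0) + longAscentsAux 0 s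
longAscentsAux k [] = if 2 ≤ᵇ k then 1 else 0

longAscents : List Step → ℕ
longAscents = longAscentsAux 0

DyckAtMostOneLong : ℕ → Set
DyckAtMostOneLong n =
  Σ (Vec Step (n + n)) (λ p → T (isDyck (toList p) ∧ (longAscents (toList p) ≤ᵇ 1)))

module Submission where

-- Both sets are put in bijection with Code n, where Code 0 is a point and Code (n + 1) is
-- Code n plus the nonempty subsets of an n-element set (bit lists containing a 1).
--
-- A Grassmannian permutation of {0, …, n} either starts with 0, and what follows is a
-- Grassmannian permutation of {1, …, n}; or it is A 0 B with A nonempty, A and B increasing
-- and complementary in {1, …, n}, its only descent being the one into 0, so that it is
-- determined by A.
--
-- A Dyck path with at most one long ascent either starts with a peak UD followed by a shorter
-- such path; or it starts with its only long ascent U^(t+1) D, t ≥ 1, after which it is a word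
-- in D and UD.  Reading D as 1 and UD as 0, this word is a bit list with exactly t ones, and
-- every bit list containing a 1 arises in this way.

open import Defs
open import Data.Nat
  using (ℕ; zero; suc; pred; ⌊_/2⌋; _+_; _≤_; _<_; _≥_; _≤ᵇ_; _<ᵇ_; _≡ᵇ_; z≤n; s≤s; z<s)
open import Data.Nat.Properties
  using (_≟_; ≡-irrelevant; suc-injective; +-suc; +-comm; +-assoc; +-identityʳ; ≤-refl; ≤-pred; <⇒≤;
         ≤∧≢⇒<; <-irrefl; <-asym; <-trans; <⇒≢; >⇒≢; <⇒≱; ≮⇒≥; m≤n⇒m≤1+n; n≤0⇒n≡0; m<n⇒m<1+n; m≤m+n;
         m+n≡0⇒m≡0; m+n≡0⇒n≡0;
         ≡ᵇ⇒≡; ≡⇒≡ᵇ; <ᵇ⇒<; <⇒<ᵇ; ≤ᵇ⇒≤; ≤⇒≤ᵇ; n≡⌊n+n/2⌋)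
open import Data.Bool using (Bool; true; false; _∧_; _∨_; not; T; if_then_else_)
open import Data.Bool.Properties using (T?; T-irrelevant; T-∨)
open import Data.Fin using (Fin; toℕ; fromℕ<)
open import Data.Fin.Properties using (fromℕ<-toℕ; toℕ-fromℕ<; toℕ<n)
open import Data.Vec using (Vec; []; _∷_; toList)
open import Data.Vec.Properties using (length-toList)
open import Data.List using (List; []; _∷_; length; map; replicate; drop; _++_)
open import Data.Bool.ListAction using (or)
open import Data.List.Properties using (length-map; length-++; length-++-sucʳ; length-replicate; map-∘; map-id)
open import Data.Product using (Σ; Σ-syntax; _,_; _×_; proj₁; proj₂)
open import Data.Sum using (_⊎_; inj₁; inj₂; map₁)
open import Data.Empty using (⊥-elim)
open import Function using (_∘_)
open import Function.Bundles using (_⤖_; _↔_; mk↔ₛ′; Equivalence)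
open import Function.Properties.Inverse using (↔-trans; ↔-sym; ↔⇒⤖)
open import Relation.Nullary using (¬_; yes; no)
open import Relation.Binary.PropositionalEquality

∧-elimˡ : ∀ {a b} → T (a ∧ b) → T a
∧-elimˡ {true} _ = _

∧-elimʳ : ∀ {a b} → T (a ∧ b) → T b
∧-elimʳ {true} p = p

∧-intro : ∀ {a b} → T a → T b → T (a ∧ b)
∧-intro {true} _ q = q

SizedList : (A : Set) → ℕ → (List A → Bool) → Set
SizedList A m P = Σ[ l ∈ List A ] length l ≡ m × T (P l)

Σ-T-≡ : {A : Set} {P : A → Bool} {a b : A} {p : T (P a)} {q : T (P b)} →
        a ≡ b → _≡_ {A = Σ A (λ x → T (P x))} (a , p) (b , q)
Σ-T-≡ {p = p} {q} refl = cong (_ ,_) (T-irrelevant p q)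

SizedList-≡ : {A : Set} {m : ℕ} {P : List A → Bool} {l l′ : List A}
              {e : length l ≡ m} {e′ : length l′ ≡ m} {p : T (P l)} {p′ : T (P l′)} →
              l ≡ l′ → _≡_ {A = SizedList A m P} (l , e , p) (l′ , e′ , p′)
SizedList-≡ {e = e} {e′} {p = p} {p′} refl
  rewrite ≡-irrelevant e e′ | T-irrelevant p p′ = refl

SizedList-cong : {A : Set} {m : ℕ} {P Q : List A → Bool} →
                 (∀ l → P l ≡ Q l) → SizedList A m P ↔ SizedList A m Q
SizedList-cong P≡Q = mk↔ₛ′ (λ { (l , e , p) → l , e , subst T (P≡Q l) p })
                           (λ { (l , e , q) → l , e , subst T (sym (P≡Q l)) q })
                           (λ _ → SizedList-≡ refl) (λ _ → SizedList-≡ refl)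

onto∧leftInverse⇒↔ : {A C : Set} {m : ℕ} {P : List A → Bool} (dec : C → List A) (enc : List A → C) →
                     (∀ c → length (dec c) ≡ m) → (∀ c → T (P (dec c))) → (∀ c → enc (dec c) ≡ c) →
                     (∀ l → length l ≡ m → T (P l) → Σ[ c ∈ C ] dec c ≡ l) →
                     C ↔ SizedList A m P
onto∧leftInverse⇒↔ {m = m} {P} dec enc length-dec P-dec enc-dec dec-onto = mk↔ₛ′
  (λ c → dec c , length-dec c , P-dec c)
  (λ { (l , _ , _) → enc l })
  (λ { (l , e , p) → SizedList-≡ (dec-enc l e p) })
  enc-dec
  where
  dec-enc : ∀ l → length l ≡ m → T (P l) → dec (enc l) ≡ l
  dec-enc l e p with dec-onto l e p
  ... | c , refl = cong dec (enc-dec c)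

listToVec : {A : Set} {m : ℕ} (l : List A) → length l ≡ m → Vec A m
listToVec {m = zero}  []      _ = []
listToVec {m = suc m} (x ∷ l) e = x ∷ listToVec l (suc-injective e)

toList-listToVec : {A : Set} {m : ℕ} (l : List A) (e : length l ≡ m) → toList (listToVec l e) ≡ l
toList-listToVec {m = zero}  []      _ = refl
toList-listToVec {m = suc m} (x ∷ l) e = cong (x ∷_) (toList-listToVec l (suc-injective e))

listToVec-toList : {A : Set} {m : ℕ} (v : Vec A m) (e : length (toList v) ≡ m) → listToVec (toList v) e ≡ v
listToVec-toList []      _ = refl
listToVec-toList (x ∷ v) e = cong (x ∷_) (listToVec-toList v (suc-injective e))

vec↔SizedList : {A : Set} (m : ℕ) (P : List A → Bool) →
                Σ (Vec A m) (λ v → T (P (toList v))) ↔ SizedList A m P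
vec↔SizedList m P = mk↔ₛ′
  (λ { (v , p) → toList v , length-toList v , p })
  (λ { (l , e , p) → listToVec l e , subst (λ l → T (P l)) (sym (toList-listToVec l e)) p })
  (λ { (l , e , p) → SizedList-≡ (toList-listToVec l e) })
  (λ { (v , p) → Σ-T-≡ (listToVec-toList v (length-toList v)) })

allBelow : ℕ → List ℕ → Bool
allBelow n []      = true
allBelow n (x ∷ l) = (x <ᵇ n) ∧ allBelow n l

toFins : (n : ℕ) (l : List ℕ) → T (allBelow n l) → List (Fin n)
toFins n []      _ = []
toFins n (x ∷ l) p = fromℕ< (<ᵇ⇒< x n (∧-elimˡ p)) ∷ toFins n l (∧-elimʳ p)

map-toℕ-toFins : (n : ℕ) (l : List ℕ) (p : T (allBelow n l)) → map toℕ (toFins n l p) ≡ l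
map-toℕ-toFins n []      _ = refl
map-toℕ-toFins n (x ∷ l) p = cong₂ _∷_ (toℕ-fromℕ< _) (map-toℕ-toFins n l (∧-elimʳ p))

toFins-map-toℕ : (n : ℕ) (l : List (Fin n)) (p : T (allBelow n (map toℕ l))) → toFins n (map toℕ l) p ≡ l
toFins-map-toℕ n []      _ = refl
toFins-map-toℕ n (x ∷ l) p = cong₂ _∷_ (fromℕ<-toℕ x _) (toFins-map-toℕ n l (∧-elimʳ p))

allBelow-map-toℕ : (n : ℕ) (l : List (Fin n)) → T (allBelow n (map toℕ l))
allBelow-map-toℕ n []      = _
allBelow-map-toℕ n (x ∷ l) = ∧-intro (<⇒<ᵇ (toℕ<n x)) (allBelow-map-toℕ n l)

length-toFins : (n : ℕ) (l : List ℕ) (p : T (allBelow n l)) → length (toFins n l p) ≡ length l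
length-toFins n []      _ = refl
length-toFins n (x ∷ l) p = cong suc (length-toFins n l (∧-elimʳ p))

finList↔natList : (n m : ℕ) (P : List ℕ → Bool) →
                  SizedList (Fin n) m (λ l → P (map toℕ l)) ↔ SizedList ℕ m (λ l → allBelow n l ∧ P l)
finList↔natList n m P = mk↔ₛ′
  (λ { (l , e , p) → map toℕ l , trans (length-map toℕ l) e , ∧-intro (allBelow-map-toℕ n l) p })
  (λ { (l , e , p) → toFins n l (∧-elimˡ p) , trans (length-toFins n l (∧-elimˡ p)) e
                   , subst (λ l → T (P l)) (sym (map-toℕ-toFins n l (∧-elimˡ p))) (∧-elimʳ p) })
  (λ { (l , e , p) → SizedList-≡ (map-toℕ-toFins n l (∧-elimˡ p)) })
  (λ { (l , e , p) → SizedList-≡ (toFins-map-toℕ n l _) })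

data Code : ℕ → Set where
  empty : Code 0
  lead  : ∀ {n} → Code n → Code (suc n)
  split : ∀ {n} (bs : List Bool) → length bs ≡ n → T (or bs) → Code (suc n)

split-≡ : ∀ {n} {bs bs′ : List Bool} {e : length bs ≡ n} {e′ : length bs′ ≡ n}
          {p : T (or bs)} {p′ : T (or bs′)} → bs ≡ bs′ → split bs e p ≡ split bs′ e′ p′
split-≡ {e = e} {e′} {p} {p′} refl rewrite ≡-irrelevant e e′ | T-irrelevant p p′ = refl

splitOrLead : ∀ {n} → List Bool → Code n → Code (suc n)
splitOrLead {n} bs c with length bs ≟ n | T? (or bs)
... | yes e | yes p = split bs e p
... | _     | _     = lead c

splitOrLead-split : ∀ {n} bs (c : Code n) (e : length bs ≡ n) (p : T (or bs)) →
                    splitOrLead bs c ≡ split bs e p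
splitOrLead-split {n} bs c e p with length bs ≟ n | T? (or bs)
... | yes _ | yes _ = split-≡ refl
... | no ¬e | _     = ⊥-elim (¬e e)
... | yes _ | no ¬p = ⊥-elim (¬p p)

splitOrLead-lead : ∀ {n} bs (c : Code n) → or bs ≡ false → splitOrLead bs c ≡ lead c
splitOrLead-lead {n} bs c f with length bs ≟ n | T? (or bs)
... | yes _ | yes p = ⊥-elim (subst T f p)
... | yes _ | no _  = refl
... | no _  | _     = refl

-- Dyck paths

countTrue : List Bool → ℕ
countTrue []           = 0
countTrue (true ∷ bs)  = suc (countTrue bs)
countTrue (false ∷ bs) = countTrue bs

bitsToPath : List Bool → List Step
bitsToPath []           = []
bitsToPath (true ∷ bs)  = D ∷ bitsToPath bs
bitsToPath (false ∷ bs) = U ∷ D ∷ bitsToPath bs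

pathToBits : List Step → List Bool
pathToBits (D ∷ s)     = true ∷ pathToBits s
pathToBits (U ∷ D ∷ s) = false ∷ pathToBits s
pathToBits _           = []

afterFirstDown : List Step → List Step
afterFirstDown (U ∷ s) = afterFirstDown s
afterFirstDown (D ∷ s) = s
afterFirstDown []      = []

ascent : ℕ → List Step → List Step
ascent t s = replicate t U ++ D ∷ s

splitPath : List Bool → List Step
splitPath bs = U ∷ ascent (countTrue bs) (bitsToPath bs)

codeToPath : ∀ {n} → Code n → List Step
codeToPath empty          = []
codeToPath (lead c)       = U ∷ D ∷ codeToPath c
codeToPath (split bs _ _) = splitPath bs

pathToCode : (n : ℕ) → List Step → Code n
pathToCode zero    _           = empty
pathToCode (suc n) (U ∷ U ∷ s) = splitOrLead (pathToBits (afterFirstDown s)) (pathToCode n [])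
pathToCode (suc n) (U ∷ D ∷ s) = lead (pathToCode n s)
pathToCode (suc n) _           = lead (pathToCode n [])

pathToBits-bitsToPath : ∀ bs → pathToBits (bitsToPath bs) ≡ bs
pathToBits-bitsToPath []           = refl
pathToBits-bitsToPath (true ∷ bs)  = cong (true ∷_) (pathToBits-bitsToPath bs)
pathToBits-bitsToPath (false ∷ bs) = cong (false ∷_) (pathToBits-bitsToPath bs)

afterFirstDown-ascent : ∀ t s → afterFirstDown (ascent t s) ≡ s
afterFirstDown-ascent zero    s = refl
afterFirstDown-ascent (suc t) s = afterFirstDown-ascent t s

length-ascent : ∀ t s → length (ascent t s) ≡ t + suc (length s)
length-ascent t s = trans (length-++ (replicate t U)) (cong (_+ suc (length s)) (length-replicate t))

dyckFrom-U : ∀ h s → dyckFrom h (U ∷ s) ≡ dyckFrom (suc h) s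
dyckFrom-U zero    s = refl
dyckFrom-U (suc h) s = refl

dyckFrom-ascent : ∀ h t s → dyckFrom (suc h) (ascent t s) ≡ dyckFrom (t + h) s
dyckFrom-ascent h zero    s = refl
dyckFrom-ascent h (suc t) s rewrite dyckFrom-ascent (suc h) t s | +-suc t h = refl

longAscentsAux-ascent : ∀ k t s → longAscentsAux k (ascent t s) ≡ longAscentsAux (t + k) (D ∷ s)
longAscentsAux-ascent k zero    s = refl
longAscentsAux-ascent k (suc t) s rewrite longAscentsAux-ascent (suc k) t s | +-suc t k = refl

dyckFrom-bitsToPath : ∀ bs → T (dyckFrom (countTrue bs) (bitsToPath bs))
dyckFrom-bitsToPath []           = _
dyckFrom-bitsToPath (true ∷ bs)  = dyckFrom-bitsToPath bs
dyckFrom-bitsToPath (false ∷ bs) = subst T (sym (dyckFrom-U (countTrue bs) _)) (dyckFrom-bitsToPath bs)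

longAscents-bitsToPath : ∀ bs → longAscents (bitsToPath bs) ≡ 0
longAscents-bitsToPath []           = refl
longAscents-bitsToPath (true ∷ bs)  = longAscents-bitsToPath bs
longAscents-bitsToPath (false ∷ bs) = longAscents-bitsToPath bs

length-bitsToPath : ∀ bs → countTrue bs + length (bitsToPath bs) ≡ length bs + length bs
length-bitsToPath [] = refl
length-bitsToPath (true ∷ bs) = begin
  suc (countTrue bs + suc (length (bitsToPath bs))) ≡⟨ cong suc (+-suc _ _) ⟩
  suc (suc (countTrue bs + length (bitsToPath bs))) ≡⟨ cong (suc ∘ suc) (length-bitsToPath bs) ⟩
  suc (suc (length bs + length bs))                 ≡⟨ cong suc (+-suc _ _) ⟨
  suc (length bs + suc (length bs))                 ∎
  where open ≡-Reasoning
length-bitsToPath (false ∷ bs) = begin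
  countTrue bs + suc (suc (length (bitsToPath bs))) ≡⟨ trans (+-suc _ _) (cong suc (+-suc _ _)) ⟩
  suc (suc (countTrue bs + length (bitsToPath bs))) ≡⟨ cong (suc ∘ suc) (length-bitsToPath bs) ⟩
  suc (suc (length bs + length bs))                 ≡⟨ cong suc (+-suc _ _) ⟨
  suc (length bs + suc (length bs))                 ∎
  where open ≡-Reasoning

length-splitPath : ∀ bs → length (splitPath bs) ≡ suc (length bs) + suc (length bs)
length-splitPath bs = begin
  suc (length (ascent (countTrue bs) (bitsToPath bs))) ≡⟨ cong suc (length-ascent _ _) ⟩
  suc (countTrue bs + suc (length (bitsToPath bs)))    ≡⟨ cong suc (+-suc _ _) ⟩
  suc (suc (countTrue bs + length (bitsToPath bs)))    ≡⟨ cong (suc ∘ suc) (length-bitsToPath bs) ⟩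
  suc (suc (length bs + length bs))                    ≡⟨ cong suc (+-suc _ _) ⟨
  suc (length bs + suc (length bs))                    ∎
  where open ≡-Reasoning

isDyckAtMostOneLong : List Step → Bool
isDyckAtMostOneLong s = isDyck s ∧ (longAscents s ≤ᵇ 1)

double-injective : ∀ a b → a + a ≡ b + b → a ≡ b
double-injective a b e = trans (n≡⌊n+n/2⌋ a) (trans (cong ⌊_/2⌋ e) (sym (n≡⌊n+n/2⌋ b)))

codeToPath-length : ∀ {n} (c : Code n) → length (codeToPath c) ≡ n + n
codeToPath-length empty             = refl
codeToPath-length (lead {n} c)      = cong suc (trans (cong suc (codeToPath-length c)) (sym (+-suc n n)))
codeToPath-length (split bs refl _) = length-splitPath bs

splitPath-dyck : ∀ bs → T (isDyck (splitPath bs))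
splitPath-dyck bs rewrite dyckFrom-ascent 0 (countTrue bs) (bitsToPath bs) | +-identityʳ (countTrue bs) =
  dyckFrom-bitsToPath bs

splitPath-longAscents : ∀ bs → T (longAscents (splitPath bs) ≤ᵇ 1)
splitPath-longAscents bs
  rewrite longAscentsAux-ascent 1 (countTrue bs) (bitsToPath bs) | longAscents-bitsToPath bs
  with 2 ≤ᵇ countTrue bs + 1
... | true  = _
... | false = _

codeToPath-valid : ∀ {n} (c : Code n) → T (isDyckAtMostOneLong (codeToPath c))
codeToPath-valid empty          = _
codeToPath-valid (lead c)       = codeToPath-valid c
codeToPath-valid (split bs _ _) = ∧-intro (splitPath-dyck bs) (splitPath-longAscents bs)

or⇒countTrue≢0 : ∀ bs → T (or bs) → countTrue bs ≢ 0
or⇒countTrue≢0 (true ∷ bs)  _ ()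
or⇒countTrue≢0 (false ∷ bs) p = or⇒countTrue≢0 bs p

countTrue≡suc⇒or : ∀ bs {t} → countTrue bs ≡ suc t → T (or bs)
countTrue≡suc⇒or (true ∷ bs)  _ = _
countTrue≡suc⇒or (false ∷ bs) e = countTrue≡suc⇒or bs e

pathToCode-codeToPath : ∀ {n} (c : Code n) → pathToCode n (codeToPath c) ≡ c
pathToCode-codeToPath empty              = refl
pathToCode-codeToPath (lead c)           = cong lead (pathToCode-codeToPath c)
pathToCode-codeToPath (split bs e p) with countTrue bs in eq
... | zero  = ⊥-elim (or⇒countTrue≢0 bs p eq)
... | suc t rewrite afterFirstDown-ascent t (bitsToPath bs) | pathToBits-bitsToPath bs =
  splitOrLead-split bs _ e p

longAscentsAux-long : ∀ k s → longAscentsAux (suc (suc k)) s ≢ 0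
longAscentsAux-long k (U ∷ s) = longAscentsAux-long (suc k) s
longAscentsAux-long k (D ∷ s) ()
longAscentsAux-long k []      ()

noLongAscent⇒bitsToPath : ∀ h s → longAscents s ≡ 0 → T (dyckFrom h s) →
                          Σ[ bs ∈ List Bool ] bitsToPath bs ≡ s × countTrue bs ≡ h
noLongAscent⇒bitsToPath zero    []          _ _ = [] , refl , refl
noLongAscent⇒bitsToPath (suc h) (D ∷ s)     z d with noLongAscent⇒bitsToPath h s z d
... | bs , refl , refl = true ∷ bs , refl , refl
noLongAscent⇒bitsToPath h       (U ∷ D ∷ s) z d with noLongAscent⇒bitsToPath h s z (subst T (dyckFrom-U h _) d)
... | bs , refl , refl = false ∷ bs , refl , refl
noLongAscent⇒bitsToPath h       (U ∷ U ∷ s) z _ = ⊥-elim (longAscentsAux-long 0 s z)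
noLongAscent⇒bitsToPath zero    (U ∷ [])    _ ()
noLongAscent⇒bitsToPath (suc h) (U ∷ [])    _ ()

dyckFrom⇒ascent : ∀ h s → T (dyckFrom (suc h) s) → Σ[ j ∈ ℕ ] Σ[ V ∈ List Step ] s ≡ ascent j V
dyckFrom⇒ascent h (D ∷ V) _ = 0 , V , refl
dyckFrom⇒ascent h (U ∷ s) d with dyckFrom⇒ascent (suc h) s d
... | j , V , refl = suc j , V , refl

splitPath-onto : ∀ s → T (isDyckAtMostOneLong (U ∷ U ∷ s)) →
                 Σ[ bs ∈ List Bool ] T (or bs) × splitPath bs ≡ U ∷ U ∷ s
splitPath-onto s p with dyckFrom⇒ascent 1 s (∧-elimˡ p)
... | j , V , refl with noLongAscent⇒bitsToPath (suc j) V rest-flat rest-dyck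
  where
  rest-dyck : T (dyckFrom (suc j) V)
  rest-dyck = subst (λ h → T (dyckFrom h V)) (+-comm j 1)
                (subst T (dyckFrom-ascent 1 j V) (∧-elimˡ p))
  rest-flat : longAscents V ≡ 0
  rest-flat = n≤0⇒n≡0 (≤-pred (≤ᵇ⇒≤ _ 1
                (subst (λ k → T (longAscentsAux k (D ∷ V) ≤ᵇ 1)) (+-comm j 2)
                  (subst (λ m → T (m ≤ᵇ 1)) (longAscentsAux-ascent 2 j V) (∧-elimʳ p)))))
... | bs , refl , eq = bs , countTrue≡suc⇒or bs eq , cong (λ t → U ∷ ascent t (bitsToPath bs)) eq

codeToPath-onto : ∀ n s → length s ≡ n + n → T (isDyckAtMostOneLong s) → Σ[ c ∈ Code n ] codeToPath c ≡ s
codeToPath-onto zero    []          _ _ = empty , refl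
codeToPath-onto (suc n) (U ∷ D ∷ s) e p
  with codeToPath-onto n s (suc-injective (trans (suc-injective e) (+-suc n n))) p
... | c , refl = lead c , refl
codeToPath-onto (suc n) (U ∷ U ∷ s) e p with splitPath-onto s p
... | bs , p-bs , eq = split bs length-bs p-bs , eq
  where
  length-bs : length bs ≡ n
  length-bs =
    suc-injective (double-injective _ _ (trans (sym (length-splitPath bs)) (trans (cong length eq) e)))
codeToPath-onto (suc n) (U ∷ [])    e _ with trans (suc-injective e) (+-suc n n)
... | ()
codeToPath-onto (suc n) (D ∷ s)     _ ()

code↔dyckPaths : ∀ n → Code n ↔ SizedList Step (n + n) isDyckAtMostOneLong
code↔dyckPaths n =
  onto∧leftInverse⇒↔ codeToPath (pathToCode n) codeToPath-length codeToPath-valid pathToCode-codeToPath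
                     (codeToPath-onto n)

_∈ᵇ_ : ℕ → List ℕ → Bool
x ∈ᵇ []      = false
x ∈ᵇ (y ∷ l) = (x ≡ᵇ y) ∨ (x ∈ᵇ l)

infix 4 _∈_ _∉_

_∈_ _∉_ : ℕ → List ℕ → Set
x ∈ l = T (x ∈ᵇ l)
x ∉ l = ¬ x ∈ l

∈-here : ∀ x l → x ∈ x ∷ l
∈-here x l = Equivalence.from (T-∨ {x ≡ᵇ x}) (inj₁ (≡⇒≡ᵇ x x refl))

∈-there : ∀ {x} y l → x ∈ l → x ∈ y ∷ l
∈-there {x} y l p = Equivalence.from (T-∨ {x ≡ᵇ y}) (inj₂ p)

∈-∷⁻ : ∀ {x} y l → x ∈ y ∷ l → x ≡ y ⊎ x ∈ l
∈-∷⁻ {x} y l p = map₁ (≡ᵇ⇒≡ x y) (Equivalence.to (T-∨ {x ≡ᵇ y}) p)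

∈-++⁺ˡ : ∀ {x} A C → x ∈ A → x ∈ A ++ C
∈-++⁺ˡ (y ∷ A) C p with ∈-∷⁻ y A p
... | inj₁ refl = ∈-here y (A ++ C)
... | inj₂ q    = ∈-there y (A ++ C) (∈-++⁺ˡ A C q)

∈-++⁺ʳ : ∀ {x} A C → x ∈ C → x ∈ A ++ C
∈-++⁺ʳ []      C p = p
∈-++⁺ʳ (y ∷ A) C p = ∈-there y (A ++ C) (∈-++⁺ʳ A C p)

∈-++⁻ : ∀ {x} A C → x ∈ A ++ C → x ∈ A ⊎ x ∈ C
∈-++⁻ []      C p = inj₂ p
∈-++⁻ (y ∷ A) C p with ∈-∷⁻ y (A ++ C) p
... | inj₁ refl = inj₁ (∈-here y A)
... | inj₂ q    = map₁ (∈-there y A) (∈-++⁻ A C q)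

Every : (ℕ → Set) → List ℕ → Set
Every P l = ∀ y → y ∈ l → P y

Every-[] : ∀ {P} → Every P []
Every-[] _ ()

Every-∷ : ∀ {P : ℕ → Set} {x} l → P x → Every P l → Every P (x ∷ l)
Every-∷ l px ps y m with ∈-∷⁻ _ l m
... | inj₁ refl = px
... | inj₂ q    = ps y q

Every-head : ∀ {P} x l → Every P (x ∷ l) → P x
Every-head x l ps = ps x (∈-here x l)

Every-tail : ∀ {P} x l → Every P (x ∷ l) → Every P l
Every-tail x l ps y m = ps y (∈-there x l m)

Every<⇒allBelow : ∀ n l → Every (_< n) l → T (allBelow n l)
Every<⇒allBelow n []      _       = _
Every<⇒allBelow n (x ∷ l) bounded =
  ∧-intro (<⇒<ᵇ (Every-head x l bounded)) (Every<⇒allBelow n l (Every-tail x l bounded))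

allBelow⇒Every< : ∀ n l → T (allBelow n l) → Every (_< n) l
allBelow⇒Every< n []      _ = Every-[]
allBelow⇒Every< n (x ∷ l) p =
  Every-∷ l (<ᵇ⇒< x n (∧-elimˡ p)) (allBelow⇒Every< n l (∧-elimʳ {x <ᵇ n} p))

distinctFromℕ : ℕ → List ℕ → Bool
distinctFromℕ x []      = true
distinctFromℕ x (y ∷ l) = not (x ≡ᵇ y) ∧ distinctFromℕ x l

allDistinctℕ : List ℕ → Bool
allDistinctℕ []      = true
allDistinctℕ (x ∷ l) = distinctFromℕ x l ∧ allDistinctℕ l

Distinct : List ℕ → Set
Distinct l = T (allDistinctℕ l)

≡ᵇ-refl : ∀ x → (x ≡ᵇ x) ≡ true
≡ᵇ-refl zero    = refl
≡ᵇ-refl (suc x) = ≡ᵇ-refl x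

distinctFromℕ⇒∉ : ∀ x l → T (distinctFromℕ x l) → x ∉ l
distinctFromℕ⇒∉ x (y ∷ l) d m with ∈-∷⁻ y l m
... | inj₁ refl rewrite ≡ᵇ-refl x = d
... | inj₂ q    = distinctFromℕ⇒∉ x l (∧-elimʳ {not (x ≡ᵇ y)} d) q

∉⇒distinctFromℕ : ∀ x l → x ∉ l → T (distinctFromℕ x l)
∉⇒distinctFromℕ x []      _  = _
∉⇒distinctFromℕ x (y ∷ l) x∉ with x ≡ᵇ y
... | true  = ⊥-elim (x∉ _)
... | false = ∉⇒distinctFromℕ x l x∉

distinct-∷ : ∀ {x} l → x ∉ l → Distinct l → Distinct (x ∷ l)
distinct-∷ l x∉ d = ∧-intro (∉⇒distinctFromℕ _ l x∉) d

distinct-head : ∀ x l → Distinct (x ∷ l) → x ∉ l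
distinct-head x l d = distinctFromℕ⇒∉ x l (∧-elimˡ d)

distinct-tail : ∀ x l → Distinct (x ∷ l) → Distinct l
distinct-tail x l d = ∧-elimʳ {distinctFromℕ x l} d

distinct-++ˡ : ∀ A C → Distinct (A ++ C) → Distinct A
distinct-++ˡ []      C d = _
distinct-++ˡ (x ∷ A) C d = distinct-∷ A (distinct-head x (A ++ C) d ∘ ∈-++⁺ˡ A C)
                             (distinct-++ˡ A C (distinct-tail x (A ++ C) d))

distinct-++ʳ : ∀ A C → Distinct (A ++ C) → Distinct C
distinct-++ʳ []      C d = d
distinct-++ʳ (x ∷ A) C d = distinct-++ʳ A C (distinct-tail x (A ++ C) d)

distinct-++-disjoint : ∀ {x} A C → Distinct (A ++ C) → x ∈ A → x ∉ C
distinct-++-disjoint (y ∷ A) C d x∈A x∈C with ∈-∷⁻ y A x∈A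
... | inj₁ refl = distinct-head y (A ++ C) d (∈-++⁺ʳ A C x∈C)
... | inj₂ q    = distinct-++-disjoint A C (distinct-tail y (A ++ C) d) q x∈C

distinct-++ : ∀ A C → Distinct A → Distinct C → (∀ {x} → x ∈ A → x ∉ C) → Distinct (A ++ C)
distinct-++ []      C _  dC _        = dC
distinct-++ (x ∷ A) C dA dC disjoint =
  distinct-∷ (A ++ C) x∉A++C (distinct-++ A C (distinct-tail x A dA) dC (disjoint ∘ ∈-there x A))
  where
  x∉A++C : x ∉ A ++ C
  x∉A++C m with ∈-++⁻ A C m
  ... | inj₁ q = distinct-head x A dA q
  ... | inj₂ q = disjoint (∈-here x A) q

∈-split : ∀ {x} l → x ∈ l → Σ[ p ∈ List ℕ ] Σ[ q ∈ List ℕ ] l ≡ p ++ x ∷ q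
∈-split (y ∷ l) m with ∈-∷⁻ y l m
... | inj₁ refl = [] , l , refl
... | inj₂ q with ∈-split l q
... | p , r , refl = y ∷ p , r , refl

∈-insert : ∀ {z} x p q → z ∈ p ++ q → z ∈ p ++ x ∷ q
∈-insert x p q m with ∈-++⁻ p q m
... | inj₁ a = ∈-++⁺ˡ p _ a
... | inj₂ b = ∈-++⁺ʳ p _ (∈-there x q b)

distinct-remove : ∀ x p q → Distinct (p ++ x ∷ q) → Distinct (p ++ q)
distinct-remove x []      q d = distinct-tail x q d
distinct-remove x (y ∷ p) q d =
  distinct-∷ (p ++ q) (distinct-head y (p ++ x ∷ q) d ∘ ∈-insert x p q)
    (distinct-remove x p q (distinct-tail y (p ++ x ∷ q) d))

distinct-removed-∉ : ∀ x p q → Distinct (p ++ x ∷ q) → x ∉ p ++ q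
distinct-removed-∉ x p q d m with ∈-++⁻ p q m
... | inj₁ a = distinct-++-disjoint p (x ∷ q) d a (∈-here x q)
... | inj₂ b = distinct-head x q (distinct-++ʳ p (x ∷ q) d) b

Every<-shrink : ∀ m l → Every (_< suc m) l → m ∉ l → Every (_< m) l
Every<-shrink m l bounded m∉ y y∈ = ≤∧≢⇒< (≤-pred (bounded y y∈)) λ { refl → m∉ y∈ }

distinct-length≤ : ∀ m l → Distinct l → Every (_< m) l → length l ≤ m
distinct-length≤ zero    []      _ _       = z≤n
distinct-length≤ zero    (x ∷ l) _ bounded with Every-head x l bounded
... | ()
distinct-length≤ (suc m) l d bounded with T? (m ∈ᵇ l)
... | no m∉ = m≤n⇒m≤1+n (distinct-length≤ m l d (Every<-shrink m l bounded m∉))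
... | yes m∈ with ∈-split l m∈
... | p , q , refl rewrite length-++-sucʳ p m q =
  s≤s (distinct-length≤ m (p ++ q) (distinct-remove m p q d)
         (Every<-shrink m (p ++ q) (λ y → bounded y ∘ ∈-insert m p q) (distinct-removed-∉ m p q d)))

distinct-full-∈ : ∀ n l → Distinct l → Every (_< n) l → length l ≡ n → ∀ {x} → x < n → x ∈ l
distinct-full-∈ n l d bounded e {x} x<n with T? (x ∈ᵇ l)
... | yes x∈ = x∈
... | no x∉  =
  ⊥-elim (<-irrefl e (distinct-length≤ n (x ∷ l) (distinct-∷ l x∉ d) (Every-∷ l x<n bounded)))

descentsℕ : List ℕ → ℕ
descentsℕ []          = 0
descentsℕ (x ∷ [])    = 0
descentsℕ (x ∷ y ∷ l) = (if y <ᵇ x then 1 else 0) + descentsℕ (y ∷ l)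

data Increasing : List ℕ → Set where
  inc[] : Increasing []
  inc∷  : ∀ {x l} → Every (x <_) l → Increasing l → Increasing (x ∷ l)

Increasing⇒Distinct : ∀ {l} → Increasing l → Distinct l
Increasing⇒Distinct inc[]             = _
Increasing⇒Distinct (inc∷ {x} {l} x< i) =
  distinct-∷ l (λ x∈ → <-irrefl refl (x< x x∈)) (Increasing⇒Distinct i)

Increasing⇒descentsℕ≡0 : ∀ {l} → Increasing l → descentsℕ l ≡ 0
Increasing⇒descentsℕ≡0 inc[]                        = refl
Increasing⇒descentsℕ≡0 (inc∷ {l = []} _ _)          = refl
Increasing⇒descentsℕ≡0 (inc∷ {x} {y ∷ l} x< i) with y <ᵇ x in eq
... | true  = ⊥-elim (<-asym (Every-head y l x<) (<ᵇ⇒< y x (subst T (sym eq) _)))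
... | false = Increasing⇒descentsℕ≡0 i

Every<-∷ : ∀ {x y} l → x < y → Every (y <_) l → Every (x <_) (y ∷ l)
Every<-∷ l x<y y< = Every-∷ l x<y (λ z z∈ → <-trans x<y (y< z z∈))

Increasing-∷ : ∀ {x y l} → x < y → Increasing (y ∷ l) → Increasing (x ∷ y ∷ l)
Increasing-∷ {l = l} x<y (inc∷ y< i) = inc∷ (Every<-∷ l x<y y<) (inc∷ y< i)

descentsℕ≡0⇒Increasing : ∀ l → Distinct l → descentsℕ l ≡ 0 → Increasing l
descentsℕ≡0⇒Increasing []          _ _ = inc[]
descentsℕ≡0⇒Increasing (x ∷ [])    _ _ = inc∷ Every-[] inc[]
descentsℕ≡0⇒Increasing (x ∷ y ∷ l) d e =
  Increasing-∷ x<y (descentsℕ≡0⇒Increasing (y ∷ l) (distinct-tail x (y ∷ l) d) (m+n≡0⇒n≡0 _ e))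
  where
  y≮x : ¬ y < x
  y≮x y<x with y <ᵇ x | <⇒<ᵇ y<x | m+n≡0⇒m≡0 (if y <ᵇ x then 1 else 0) e
  ... | true | _ | ()
  x<y : x < y
  x<y = ≤∧≢⇒< (≮⇒≥ y≮x) (λ { refl → distinct-head x (x ∷ l) d (∈-here x l) })

descentsℕ-across-0 : ∀ a A B → 0 < a → Every (0 <_) A →
                     descentsℕ ((a ∷ A) ++ 0 ∷ B) ≡ suc (descentsℕ (a ∷ A) + descentsℕ (0 ∷ B))
descentsℕ-across-0 (suc a) []       B _ _   = refl
descentsℕ-across-0 a       (a′ ∷ A) B _ pos
  rewrite descentsℕ-across-0 a′ A B (Every-head a′ A pos) (Every-tail a′ A pos)
        | +-suc (if a′ <ᵇ a then 1 else 0) (descentsℕ (a′ ∷ A) + descentsℕ (0 ∷ B))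
        | +-assoc (if a′ <ᵇ a then 1 else 0) (descentsℕ (a′ ∷ A)) (descentsℕ (0 ∷ B)) = refl

beforeZero : List ℕ → List ℕ
beforeZero []          = []
beforeZero (zero ∷ l)  = []
beforeZero (suc x ∷ l) = suc x ∷ beforeZero l

afterZero : List ℕ → List ℕ
afterZero []          = []
afterZero (zero ∷ l)  = l
afterZero (suc x ∷ l) = afterZero l

beforeZero-++-afterZero : ∀ l → 0 ∈ l → beforeZero l ++ 0 ∷ afterZero l ≡ l
beforeZero-++-afterZero (zero ∷ l)  _ = refl
beforeZero-++-afterZero (suc x ∷ l) m = cong (suc x ∷_) (beforeZero-++-afterZero l m)

beforeZero-positive : ∀ l → Every (0 <_) (beforeZero l)
beforeZero-positive []          = Every-[]
beforeZero-positive (zero ∷ l)  = Every-[]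
beforeZero-positive (suc x ∷ l) = Every-∷ (beforeZero l) z<s (beforeZero-positive l)

beforeZero-++ : ∀ A B → Every (0 <_) A → beforeZero (A ++ 0 ∷ B) ≡ A
beforeZero-++ []          B _   = refl
beforeZero-++ (zero ∷ A)  B pos with Every-head zero A pos
... | ()
beforeZero-++ (suc x ∷ A) B pos = cong (suc x ∷_) (beforeZero-++ A B (Every-tail (suc x) A pos))

-- Subsets of an interval as bit lists

trues falses : ℕ → List Bool → List ℕ
trues k []           = []
trues k (true ∷ bs)  = k ∷ trues (suc k) bs
trues k (false ∷ bs) = trues (suc k) bs
falses k bs = trues k (map not bs)

indicator : ℕ → ℕ → List ℕ → List Bool
indicator zero    k A = []
indicator (suc m) k A = (k ∈ᵇ A) ∷ indicator m (suc k) A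

InRange : ℕ → ℕ → ℕ → Set
InRange k m y = k ≤ y × y < k + m

InRange-start : ∀ k m → InRange k (suc m) k
InRange-start k m = ≤-refl , subst (k <_) (sym (+-suc k m)) (s≤s (m≤m+n k m))

InRange-empty : ∀ {k y} → ¬ InRange k 0 y
InRange-empty {k} (k≤y , y<) = <⇒≱ y< (subst (_≤ _) (sym (+-identityʳ k)) k≤y)

InRange-shift : ∀ {k m y} → k < y → InRange k (suc m) y → InRange (suc k) m y
InRange-shift {k} {m} {y} k<y (_ , y<) = k<y , subst (y <_) (+-suc k m) y<

InRange-suc : ∀ {k m y} → InRange (suc k) m y → InRange k (suc m) y
InRange-suc {k} {m} {y} (k<y , y<) = <⇒≤ k<y , subst (y <_) (sym (+-suc k m)) y<

trues-range : ∀ k bs → Every (InRange k (length bs)) (trues k bs)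
trues-range k []           = Every-[]
trues-range k (true ∷ bs)  = Every-∷ (trues (suc k) bs) (InRange-start k (length bs))
                               (λ y y∈ → InRange-suc (trues-range (suc k) bs y y∈))
trues-range k (false ∷ bs) y y∈ = InRange-suc (trues-range (suc k) bs y y∈)

falses-range : ∀ k bs → Every (InRange k (length bs)) (falses k bs)
falses-range k bs =
  subst (λ m → Every (InRange k m) (falses k bs)) (length-map not bs) (trues-range k (map not bs))

trues-lowerBound : ∀ k bs → Every (k ≤_) (trues k bs)
trues-lowerBound k bs y y∈ = proj₁ (trues-range k bs y y∈)

falses-lowerBound : ∀ k bs → Every (k ≤_) (falses k bs)
falses-lowerBound k bs y y∈ = proj₁ (falses-range k bs y y∈)

trues-increasing : ∀ k bs → Increasing (trues k bs)
trues-increasing k []           = inc[]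
trues-increasing k (true ∷ bs)  = inc∷ (trues-lowerBound (suc k) bs) (trues-increasing (suc k) bs)
trues-increasing k (false ∷ bs) = trues-increasing (suc k) bs

trues-falses-disjoint : ∀ {x} k bs → x ∈ trues k bs → x ∉ falses k bs
trues-falses-disjoint k (true ∷ bs) x∈ x∈′ with ∈-∷⁻ k (trues (suc k) bs) x∈
... | inj₁ refl = <-irrefl refl (falses-lowerBound (suc k) bs _ x∈′)
... | inj₂ q    = trues-falses-disjoint (suc k) bs q x∈′
trues-falses-disjoint k (false ∷ bs) x∈ x∈′ with ∈-∷⁻ k (falses (suc k) bs) x∈′
... | inj₁ refl = <-irrefl refl (trues-lowerBound (suc k) bs _ x∈)
... | inj₂ q    = trues-falses-disjoint (suc k) bs x∈ q

length-trues+falses : ∀ k bs → length (trues k bs) + length (falses k bs) ≡ length bs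
length-trues+falses k []           = refl
length-trues+falses k (true ∷ bs)  = cong suc (length-trues+falses (suc k) bs)
length-trues+falses k (false ∷ bs) =
  trans (+-suc (length (trues (suc k) bs)) _) (cong suc (length-trues+falses (suc k) bs))

trues-nonempty : ∀ k bs → T (or bs) → Σ[ a ∈ ℕ ] Σ[ A ∈ List ℕ ] trues k bs ≡ a ∷ A
trues-nonempty k (true ∷ bs)  _ = k , trues (suc k) bs , refl
trues-nonempty k (false ∷ bs) p = trues-nonempty (suc k) bs p

length-indicator : ∀ m k A → length (indicator m k A) ≡ m
length-indicator zero    k A = refl
length-indicator (suc m) k A = cong suc (length-indicator m (suc k) A)

≢⇒≡ᵇ-false : ∀ {x y} → x ≢ y → (x ≡ᵇ y) ≡ false
≢⇒≡ᵇ-false {x} {y} x≢y with x ≡ᵇ y in eq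
... | true  = ⊥-elim (x≢y (≡ᵇ⇒≡ x y (subst T (sym eq) _)))
... | false = refl

∈ᵇ-false : ∀ k A → Every (k <_) A → (k ∈ᵇ A) ≡ false
∈ᵇ-false k []      _   = refl
∈ᵇ-false k (y ∷ A) k<A rewrite ≢⇒≡ᵇ-false (<⇒≢ (Every-head y A k<A)) =
  ∈ᵇ-false k A (Every-tail y A k<A)

indicator-below : ∀ m k y A → y < k → indicator m k (y ∷ A) ≡ indicator m k A
indicator-below zero    k y A y<k = refl
indicator-below (suc m) k y A y<k rewrite ≢⇒≡ᵇ-false (>⇒≢ y<k) =
  cong ((k ∈ᵇ A) ∷_) (indicator-below m (suc k) y A (m<n⇒m<1+n y<k))

indicator-trues : ∀ k bs → indicator (length bs) k (trues k bs) ≡ bs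
indicator-trues k []           = refl
indicator-trues k (true ∷ bs)
  rewrite ≡ᵇ-refl k | indicator-below (length bs) (suc k) k (trues (suc k) bs) ≤-refl =
  cong (true ∷_) (indicator-trues (suc k) bs)
indicator-trues k (false ∷ bs) rewrite ∈ᵇ-false k (trues (suc k) bs) (trues-lowerBound (suc k) bs) =
  cong (false ∷_) (indicator-trues (suc k) bs)

trues-indicator : ∀ m k A → Increasing A → Every (InRange k m) A → trues k (indicator m k A) ≡ A
trues-indicator zero    k []      _ _ = refl
trues-indicator zero    k (y ∷ A) _ r = ⊥-elim (InRange-empty (Every-head y A r))
trues-indicator (suc m) k []      _ _ = trues-indicator m (suc k) [] inc[] Every-[]
trues-indicator (suc m) k (y ∷ A) (inc∷ y< i) r with k ≟ y
... | yes refl rewrite ≡ᵇ-refl k | indicator-below m (suc k) k A ≤-refl =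
  cong (k ∷_) (trues-indicator m (suc k) A i (λ z z∈ → InRange-shift (y< z z∈) (r z (∈-there k A z∈))))
... | no k≢y with ≤∧≢⇒< (proj₁ (Every-head y A r)) k≢y
... | k<y rewrite ∈ᵇ-false k (y ∷ A) (Every<-∷ A k<y y<) =
  trues-indicator m (suc k) (y ∷ A) (inc∷ y< i)
    (λ z z∈ → InRange-shift (Every<-∷ A k<y y< z z∈) (r z z∈))

indicator-complement : ∀ m k A B → (∀ x → InRange k m x → (x ∈ᵇ B) ≡ not (x ∈ᵇ A)) →
                       map not (indicator m k A) ≡ indicator m k B
indicator-complement zero    k A B _ = refl
indicator-complement (suc m) k A B complement =
  cong₂ _∷_ (sym (complement k (InRange-start k m)))
            (indicator-complement m (suc k) A B (λ x r → complement x (InRange-suc r)))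

or-indicator : ∀ m k {y} A → y ∈ A → InRange k m y → T (or (indicator m k A))
or-indicator zero    k     A y∈ r = ⊥-elim (InRange-empty r)
or-indicator (suc m) k {y} A y∈ r with k ≟ y
... | yes refl = Equivalence.from (T-∨ {k ∈ᵇ A}) (inj₁ y∈)
... | no k≢y   = Equivalence.from (T-∨ {k ∈ᵇ A})
                   (inj₂ (or-indicator m (suc k) A y∈ (InRange-shift (≤∧≢⇒< (proj₁ r) k≢y) r)))

or-indicator-[] : ∀ m k → or (indicator m k []) ≡ false
or-indicator-[] zero    k = refl
or-indicator-[] (suc m) k = or-indicator-[] m (suc k)

-- Grassmannian permutations

isGrassmannianℕ : List ℕ → Bool
isGrassmannianℕ l = allDistinctℕ l ∧ (descentsℕ l ≤ᵇ 1)

codeToPerm : ∀ {n} → Code n → List ℕ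
codeToPerm empty          = []
codeToPerm (lead c)       = 0 ∷ map suc (codeToPerm c)
codeToPerm (split bs _ _) = trues 1 bs ++ 0 ∷ falses 1 bs

permToCode : (n : ℕ) → List ℕ → Code n
permToCode zero    _ = empty
permToCode (suc n) l = splitOrLead (indicator n 1 (beforeZero l)) (permToCode n (map pred (drop 1 l)))

∈ᵇ-map-suc : ∀ x L → (suc x ∈ᵇ map suc L) ≡ (x ∈ᵇ L)
∈ᵇ-map-suc x []      = refl
∈ᵇ-map-suc x (y ∷ L) = cong ((x ≡ᵇ y) ∨_) (∈ᵇ-map-suc x L)

0∉map-suc : ∀ L → 0 ∉ map suc L
0∉map-suc (y ∷ L) = 0∉map-suc L

∈-map-suc⁻ : ∀ {y} L → y ∈ map suc L → Σ[ x ∈ ℕ ] y ≡ suc x × x ∈ L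
∈-map-suc⁻ {zero}  L y∈ = ⊥-elim (0∉map-suc L y∈)
∈-map-suc⁻ {suc x} L y∈ = x , refl , subst T (∈ᵇ-map-suc x L) y∈

distinctFromℕ-map-suc : ∀ x L → distinctFromℕ (suc x) (map suc L) ≡ distinctFromℕ x L
distinctFromℕ-map-suc x []      = refl
distinctFromℕ-map-suc x (y ∷ L) = cong (not (x ≡ᵇ y) ∧_) (distinctFromℕ-map-suc x L)

distinctFromℕ-0-map-suc : ∀ L → distinctFromℕ 0 (map suc L) ≡ true
distinctFromℕ-0-map-suc []      = refl
distinctFromℕ-0-map-suc (y ∷ L) = distinctFromℕ-0-map-suc L

allDistinctℕ-map-suc : ∀ L → allDistinctℕ (map suc L) ≡ allDistinctℕ L
allDistinctℕ-map-suc []      = refl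
allDistinctℕ-map-suc (x ∷ L) = cong₂ _∧_ (distinctFromℕ-map-suc x L) (allDistinctℕ-map-suc L)

descentsℕ-map-suc : ∀ L → descentsℕ (map suc L) ≡ descentsℕ L
descentsℕ-map-suc []          = refl
descentsℕ-map-suc (x ∷ [])    = refl
descentsℕ-map-suc (x ∷ y ∷ L) = cong ((if y <ᵇ x then 1 else 0) +_) (descentsℕ-map-suc (y ∷ L))

descentsℕ-0∷ : ∀ L → descentsℕ (0 ∷ L) ≡ descentsℕ L
descentsℕ-0∷ []      = refl
descentsℕ-0∷ (y ∷ L) = refl

map-pred-map-suc : ∀ L → map pred (map suc L) ≡ L
map-pred-map-suc L = trans (sym (map-∘ L)) (map-id L)

0∉⇒map-suc : ∀ L → 0 ∉ L → Σ[ L′ ∈ List ℕ ] L ≡ map suc L′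
0∉⇒map-suc []          _  = [] , refl
0∉⇒map-suc (zero ∷ L)  0∉ = ⊥-elim (0∉ (∈-here 0 L))
0∉⇒map-suc (suc x ∷ L) 0∉ with 0∉⇒map-suc L (0∉ ∘ ∈-there (suc x) L)
... | L′ , refl = x ∷ L′ , refl

0∷falses-increasing : ∀ bs → Increasing (0 ∷ falses 1 bs)
0∷falses-increasing bs = inc∷ (falses-lowerBound 1 bs) (trues-increasing 1 (map not bs))

codeToPerm-length : ∀ {n} (c : Code n) → length (codeToPerm c) ≡ n
codeToPerm-length empty             = refl
codeToPerm-length (lead c)          = cong suc (trans (length-map suc (codeToPerm c)) (codeToPerm-length c))
codeToPerm-length (split bs refl _) =
  trans (length-++ (trues 1 bs)) (trans (+-suc _ _) (cong suc (length-trues+falses 1 bs)))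

codeToPerm-bounded : ∀ {n} (c : Code n) → Every (_< n) (codeToPerm c)
codeToPerm-bounded empty    = Every-[]
codeToPerm-bounded (lead c) = Every-∷ (map suc (codeToPerm c)) z<s bounded-suc
  where
  bounded-suc : Every (_< suc _) (map suc (codeToPerm c))
  bounded-suc y y∈ with ∈-map-suc⁻ (codeToPerm c) y∈
  ... | x , refl , x∈ = s≤s (codeToPerm-bounded c x x∈)
codeToPerm-bounded (split bs refl _) y y∈ with ∈-++⁻ (trues 1 bs) (0 ∷ falses 1 bs) y∈
... | inj₁ y∈A = proj₂ (trues-range 1 bs y y∈A)
... | inj₂ y∈B with ∈-∷⁻ 0 (falses 1 bs) y∈B
...   | inj₁ refl = z<s
...   | inj₂ y∈B′ = proj₂ (falses-range 1 bs y y∈B′)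

codeToPerm-distinct : ∀ {n} (c : Code n) → Distinct (codeToPerm c)
codeToPerm-distinct empty = _
codeToPerm-distinct (lead c)
  rewrite distinctFromℕ-0-map-suc (codeToPerm c) | allDistinctℕ-map-suc (codeToPerm c) =
  codeToPerm-distinct c
codeToPerm-distinct (split bs _ _) =
  distinct-++ (trues 1 bs) (0 ∷ falses 1 bs) (Increasing⇒Distinct (trues-increasing 1 bs))
    (Increasing⇒Distinct (0∷falses-increasing bs)) disjoint
  where
  disjoint : ∀ {x} → x ∈ trues 1 bs → x ∉ 0 ∷ falses 1 bs
  disjoint x∈ x∈′ with ∈-∷⁻ 0 (falses 1 bs) x∈′
  ... | inj₁ refl = <-irrefl refl (trues-lowerBound 1 bs 0 x∈)
  ... | inj₂ q    = trues-falses-disjoint 1 bs x∈ q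

codeToPerm-descents : ∀ {n} (c : Code n) → descentsℕ (codeToPerm c) ≤ 1
codeToPerm-descents empty = z≤n
codeToPerm-descents (lead c)
  rewrite descentsℕ-0∷ (map suc (codeToPerm c)) | descentsℕ-map-suc (codeToPerm c) =
  codeToPerm-descents c
codeToPerm-descents (split bs _ p) with trues-nonempty 1 bs p | trues-increasing 1 bs | trues-range 1 bs
... | a , A , eq | increasing | range
  rewrite eq
        | descentsℕ-across-0 a A (falses 1 bs) (proj₁ (Every-head a A range))
                             (λ y y∈ → proj₁ (Every-tail a A range y y∈))
        | Increasing⇒descentsℕ≡0 increasing | Increasing⇒descentsℕ≡0 (0∷falses-increasing bs) = ≤-refl

codeToPerm-valid : ∀ {n} (c : Code n) → T (allBelow n (codeToPerm c) ∧ isGrassmannianℕ (codeToPerm c))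
codeToPerm-valid {n} c =
  ∧-intro {allBelow n (codeToPerm c)} (Every<⇒allBelow n (codeToPerm c) (codeToPerm-bounded c))
          (∧-intro (codeToPerm-distinct c) (≤⇒≤ᵇ (codeToPerm-descents c)))

permToCode-codeToPerm : ∀ {n} (c : Code n) → permToCode n (codeToPerm c) ≡ c
permToCode-codeToPerm empty = refl
permToCode-codeToPerm {suc n} (lead c)
  rewrite splitOrLead-lead (indicator n 1 []) (permToCode n (map pred (map suc (codeToPerm c))))
                           (or-indicator-[] n 1)
        | map-pred-map-suc (codeToPerm c) = cong lead (permToCode-codeToPerm c)
permToCode-codeToPerm (split bs refl p)
  rewrite beforeZero-++ (trues 1 bs) (falses 1 bs) (trues-lowerBound 1 bs)
        | indicator-trues 1 bs = splitOrLead-split bs _ refl p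

exactlyOne⇒≡not : ∀ a b → T a ⊎ T b → ¬ (T a × T b) → b ≡ not a
exactlyOne⇒≡not true  true  _ notBoth = ⊥-elim (notBoth (_ , _))
exactlyOne⇒≡not true  false _ _       = refl
exactlyOne⇒≡not false true  _ _       = refl
exactlyOne⇒≡not false false (inj₁ ()) _
exactlyOne⇒≡not false false (inj₂ ()) _

increasing-around-0 : ∀ a A B → 0 < a → Every (0 <_) A → Distinct ((a ∷ A) ++ 0 ∷ B) →
                      descentsℕ ((a ∷ A) ++ 0 ∷ B) ≤ 1 → Increasing (a ∷ A) × Increasing (0 ∷ B)
increasing-around-0 a A B 0<a pos d ds =
  descentsℕ≡0⇒Increasing (a ∷ A) (distinct-++ˡ (a ∷ A) (0 ∷ B) d) (m+n≡0⇒m≡0 _ no-other-descent) ,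
  descentsℕ≡0⇒Increasing (0 ∷ B) (distinct-++ʳ (a ∷ A) (0 ∷ B) d) (m+n≡0⇒n≡0 _ no-other-descent)
  where
  no-other-descent : descentsℕ (a ∷ A) + descentsℕ (0 ∷ B) ≡ 0
  no-other-descent = n≤0⇒n≡0 (≤-pred (subst (_≤ 1) (descentsℕ-across-0 a A B 0<a pos) ds))

split-onto : ∀ n a A B l → (a ∷ A) ++ 0 ∷ B ≡ l → 0 < a → Every (0 <_) A →
             Every (_< suc n) l → Distinct l → descentsℕ l ≤ 1 → (∀ {x} → x < suc n → x ∈ l) →
             Σ[ c ∈ Code (suc n) ] codeToPerm c ≡ l
split-onto n a A B _ refl 0<a pos bounded d ds covers =
  split bs (length-indicator n 1 (a ∷ A)) (or-indicator n 1 (a ∷ A) (∈-here a A) (rangeA a (∈-here a A))) ,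
  cong₂ (λ X Y → X ++ 0 ∷ Y) (trues-indicator n 1 (a ∷ A) incA rangeA) falses-bs
  where
  bs = indicator n 1 (a ∷ A)
  incA : Increasing (a ∷ A)
  incA = proj₁ (increasing-around-0 a A B 0<a pos d ds)
  inc0B : Increasing (0 ∷ B)
  inc0B = proj₂ (increasing-around-0 a A B 0<a pos d ds)
  rangeA : Every (InRange 1 n) (a ∷ A)
  rangeA y y∈ = Every-∷ A 0<a pos y y∈ , bounded y (∈-++⁺ˡ (a ∷ A) (0 ∷ B) y∈)
  rangeB : Every (InRange 1 n) B
  rangeB y y∈ with inc0B
  ... | inc∷ 0< _ = 0< y y∈ , bounded y (∈-++⁺ʳ (a ∷ A) (0 ∷ B) (∈-there 0 B y∈))
  complement : ∀ x → InRange 1 n x → (x ∈ᵇ B) ≡ not (x ∈ᵇ (a ∷ A))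
  complement x (0<x , x<) = exactlyOne⇒≡not (x ∈ᵇ (a ∷ A)) (x ∈ᵇ B) in-A-or-B
                              λ (x∈A , x∈B) → distinct-++-disjoint (a ∷ A) (0 ∷ B) d x∈A (∈-there 0 B x∈B)
    where
    in-A-or-B : x ∈ a ∷ A ⊎ x ∈ B
    in-A-or-B with ∈-++⁻ (a ∷ A) (0 ∷ B) (covers x<)
    ... | inj₁ x∈A = inj₁ x∈A
    ... | inj₂ x∈0B with ∈-∷⁻ 0 B x∈0B
    ...   | inj₁ refl = ⊥-elim (<-irrefl refl 0<x)
    ...   | inj₂ x∈B  = inj₂ x∈B
  falses-bs : falses 1 bs ≡ B
  falses-bs with inc0B
  ... | inc∷ _ incB = trans (cong (trues 1) (indicator-complement n 1 (a ∷ A) B complement))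
                            (trues-indicator n 1 B incB rangeB)

codeToPerm-onto : ∀ n l → length l ≡ n → Every (_< n) l → Distinct l → descentsℕ l ≤ 1 →
                  Σ[ c ∈ Code n ] codeToPerm c ≡ l
codeToPerm-onto zero    []          _ _       _ _  = empty , refl
codeToPerm-onto (suc n) (zero ∷ l)  e bounded d ds with 0∉⇒map-suc l (distinct-head 0 l d)
... | L , refl with codeToPerm-onto n L length-L bounded-L distinct-L descents-L
  where
  length-L : length L ≡ n
  length-L = trans (sym (length-map suc L)) (suc-injective e)
  bounded-L : Every (_< n) L
  bounded-L y y∈ = ≤-pred (bounded (suc y) (∈-there 0 (map suc L) (subst T (sym (∈ᵇ-map-suc y L)) y∈)))
  distinct-L : Distinct L
  distinct-L = subst T (allDistinctℕ-map-suc L) (distinct-tail 0 (map suc L) d)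
  descents-L : descentsℕ L ≤ 1
  descents-L = subst (_≤ 1) (trans (descentsℕ-0∷ (map suc L)) (descentsℕ-map-suc L)) ds
... | c , refl = lead c , refl
codeToPerm-onto (suc n) (suc x ∷ l) e bounded d ds =
  split-onto n (suc x) (beforeZero l) (afterZero l) (suc x ∷ l)
             (beforeZero-++-afterZero (suc x ∷ l) (covers z<s)) z<s (beforeZero-positive l) bounded d ds covers
  where
  covers : ∀ {y} → y < suc n → y ∈ suc x ∷ l
  covers = distinct-full-∈ (suc n) (suc x ∷ l) d bounded e

code↔grassmannianLists : ∀ n → Code n ↔ SizedList ℕ n (λ l → allBelow n l ∧ isGrassmannianℕ l)
code↔grassmannianLists n =
  onto∧leftInverse⇒↔ codeToPerm (permToCode n) codeToPerm-length codeToPerm-valid permToCode-codeToPerm onto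
  where
  onto : ∀ l → length l ≡ n → T (allBelow n l ∧ isGrassmannianℕ l) → Σ[ c ∈ Code n ] codeToPerm c ≡ l
  onto l e p = codeToPerm-onto n l e (allBelow⇒Every< n l (∧-elimˡ p)) (∧-elimˡ grassmannian)
                 (≤ᵇ⇒≤ _ 1 (∧-elimʳ {allDistinctℕ l} grassmannian))
    where
    grassmannian : T (isGrassmannianℕ l)
    grassmannian = ∧-elimʳ {allBelow n l} p

distinctFrom-toℕ : ∀ {n} (x : Fin n) l → distinctFrom x l ≡ distinctFromℕ (toℕ x) (map toℕ l)
distinctFrom-toℕ x []      = refl
distinctFrom-toℕ x (y ∷ l) = cong (not (toℕ x ≡ᵇ toℕ y) ∧_) (distinctFrom-toℕ x l)

allDistinct-toℕ : ∀ {n} (l : List (Fin n)) → allDistinct l ≡ allDistinctℕ (map toℕ l)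
allDistinct-toℕ []      = refl
allDistinct-toℕ (x ∷ l) = cong₂ _∧_ (distinctFrom-toℕ x l) (allDistinct-toℕ l)

descents-toℕ : ∀ {n} (l : List (Fin n)) → descents l ≡ descentsℕ (map toℕ l)
descents-toℕ []          = refl
descents-toℕ (x ∷ [])    = refl
descents-toℕ (x ∷ y ∷ l) = cong ((if toℕ y <ᵇ toℕ x then 1 else 0) +_) (descents-toℕ (y ∷ l))

grassmannian↔code : ∀ n → Grassmannian n ↔ Code n
grassmannian↔code n =
  ↔-trans (vec↔SizedList n (λ l → allDistinct l ∧ (descents l ≤ᵇ 1)))
  (↔-trans (SizedList-cong λ l → cong₂ (λ a d → a ∧ (d ≤ᵇ 1)) (allDistinct-toℕ l) (descents-toℕ l))
  (↔-trans (finList↔natList n n isGrassmannianℕ)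
           (↔-sym (code↔grassmannianLists n))))

dyck↔code : ∀ n → DyckAtMostOneLong n ↔ Code n
dyck↔code n = ↔-trans (vec↔SizedList (n + n) isDyckAtMostOneLong) (↔-sym (code↔dyckPaths n))

mainTheorem7 : (n : ℕ) → n ≥ 1 → Grassmannian n ⤖ DyckAtMostOneLong n
mainTheorem7 n _ = ↔⇒⤖ (↔-trans (grassmannian↔code n) (↔-sym (dyck↔code n)))
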